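{- Let $R$ be a commutative ring and $x,y\in R$ with $Rx+Ry=R$. Then there exists $z\in R$ such that $x^2+y^2$ divides $z^2+1$ in $R$. -}

module Defs where

open import Level using (Level)
open import Algebra.Bundles using (CommutativeRing; Semiring)
import Algebra.Definitions.RawSemiring as RS

module CRingOps {c ℓ : Level} (R : CommutativeRing c ℓ) where
  open CommutativeRing R public
    using (Carrier; _+_; _*_; _≈_; 0#; 1#; semiring)
  open RS (Semiring.rawSemiring semiring) public using (_∣_; _^_)

{-# OPTIONS --safe #-}
module Submission where

open import Defs
open import Level using (Level)
open import Data.Product using (∃; ∃₂; _,_)
open import Algebra.Bundles using (CommutativeRing; CommutativeSemiring)
import Algebra.Definitions.RawMagma as RawMagma
import Algebra.Properties.Ring as RingProperties
import Algebra.Solver.Ring.NaturalCoefficients.Default as NaturalSolver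
import Relation.Binary.Reasoning.Setoid as SetoidReasoning

-- If ax + by = 1 then the Brahmagupta–Fibonacci identity
--   (a² + b²)(x² + y²) = (ax + by)² + (ay − bx)²
-- exhibits x² + y² as a divisor of z² + 1 for z = ay − bx, with quotient a² + b².

module _ {c ℓ : Level} (S : CommutativeSemiring c ℓ) where
  open CommutativeSemiring S
  open import Algebra.Definitions.RawSemiring rawSemiring using (_^_)
  open NaturalSolver S

  -- Subtraction-free, so that the ℕ-coefficient solver applies: with c standing
  -- for −b, the two sides of the identity differ by multiples of b + c.
  brahmagupta–fibonacci-mod : ∀ a b c x y →
    (a * x + b * y) ^ 2 + (a * y + c * x) ^ 2 + (b + c) * (b * x ^ 2)
      ≈ (a ^ 2 + b ^ 2) * (x ^ 2 + y ^ 2) + (b + c) * (c * x ^ 2 + (a * x * y + a * x * y))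
  brahmagupta–fibonacci-mod = solve 5 (λ a b c x y →
    (a :* x :+ b :* y) :^ 2 :+ (a :* y :+ c :* x) :^ 2 :+ (b :+ c) :* (b :* x :^ 2)
      := (a :^ 2 :+ b :^ 2) :* (x :^ 2 :+ y :^ 2) :+ (b :+ c) :* (c :* x :^ 2 :+ (a :* x :* y :+ a :* x :* y))) refl

module _ {c ℓ : Level} (R : CommutativeRing c ℓ) where
  open CommutativeRing R
  open CRingOps R using (_^_)
  open RingProperties ring using (-‿distribˡ-*)
  open import Algebra.Properties.Semiring.Exp semiring using (^-congˡ)
  open SetoidReasoning setoid

  brahmagupta–fibonacci : ∀ a b x y →
    (a ^ 2 + b ^ 2) * (x ^ 2 + y ^ 2) ≈ (a * x + b * y) ^ 2 + (a * y - b * x) ^ 2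
  brahmagupta–fibonacci a b x y = begin
    (a ^ 2 + b ^ 2) * (x ^ 2 + y ^ 2)
      ≈⟨ +-identityʳ _ ⟨
    (a ^ 2 + b ^ 2) * (x ^ 2 + y ^ 2) + 0#
      ≈⟨ +-congˡ (b-b*≈0 _) ⟨
    (a ^ 2 + b ^ 2) * (x ^ 2 + y ^ 2) + (b - b) * (- b * x ^ 2 + (a * x * y + a * x * y))
      ≈⟨ brahmagupta–fibonacci-mod commutativeSemiring a b (- b) x y ⟨
    (a * x + b * y) ^ 2 + (a * y + - b * x) ^ 2 + (b - b) * (b * x ^ 2)
      ≈⟨ trans (+-congˡ (b-b*≈0 _)) (+-identityʳ _) ⟩
    (a * x + b * y) ^ 2 + (a * y + - b * x) ^ 2
      ≈⟨ +-congˡ (^-congˡ 2 (+-congˡ (-‿distribˡ-* b x))) ⟨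
    (a * x + b * y) ^ 2 + (a * y - b * x) ^ 2 ∎
    where
    b-b*≈0 : ∀ t → (b - b) * t ≈ 0#
    b-b*≈0 t = trans (*-congʳ (-‿inverseʳ b)) (zeroˡ t)

corollary1 : ∀ {c ℓ : Level} (R : CommutativeRing c ℓ) →
    let open CRingOps R in
    (x y : Carrier) →
    ∃₂ (λ a b → a * x + b * y ≈ 1#) →
    ∃ (λ z → (x ^ 2 + y ^ 2) ∣ (z ^ 2 + 1#))
corollary1 R x y (a , b , ax+by≈1) = z , RawMagma._,_ (a ^ 2 + b ^ 2) (begin
    (a ^ 2 + b ^ 2) * (x ^ 2 + y ^ 2) ≈⟨ brahmagupta–fibonacci R a b x y ⟩
    (a * x + b * y) ^ 2 + z ^ 2       ≈⟨ +-congʳ (^-congˡ 2 ax+by≈1) ⟩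
    1# ^ 2 + z ^ 2                    ≈⟨ +-congʳ (trans (*-identityˡ _) (*-identityˡ 1#)) ⟩
    1# + z ^ 2                        ≈⟨ +-comm 1# (z ^ 2) ⟩
    z ^ 2 + 1#                        ∎)
  where
  open CommutativeRing R
  open CRingOps R using (_^_)
  open import Algebra.Properties.Semiring.Exp semiring using (^-congˡ)
  open SetoidReasoning setoid
  z : Carrier
  z = a * y - b * x
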